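{- Let $G_1$ and $G_2$ be nontrivial finite groups. Then the power graph $P(G_1\times G_2)$ is not isomorphic to the cartesian product $P(G_1)\boxtimes P(G_2)$.
   Context: For a finite group $G$, the power graph $P(G)$ is the simple undirected graph with vertex set $G$ in which two distinct vertices $a,b$ are adjacent if $a^m=b$ or $b^n=a$ for some positive integers $m,n$. For graphs $\Gamma_1,\Gamma_2$, the cartesian product $\Gamma_1\boxtimes\Gamma_2$ has vertex set $V(\Gamma_1)\times V(\Gamma_2)$, and $(g_1,g_2)\sim(g_1',g_2')$ if and only if either ($g_1=g_1'$ and $g_2\sim g_2'$) or ($g_1\sim g_1'$ and $g_2=g_2'$). -}

module Defs where

open import Level using (Level; _⊔_)
open import Data.Nat using (ℕ; zero; suc)
open import Data.Fin using (Fin)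
open import Data.Product using (Σ; ∃; _×_; _,_; proj₁; proj₂)
open import Data.Sum using (_⊎_)
open import Relation.Nullary using (¬_)
open import Relation.Binary using (Rel)
open import Relation.Binary.Bundles using (Setoid)
import Relation.Binary.PropositionalEquality as ≡
open import Function.Bundles using (Inverse; _⇔_)
open import Algebra.Bundles using (Group)
import Algebra.Construct.DirectProduct as DP
open import Data.Product.Relation.Binary.Pointwise.NonDependent using (×-setoid)

private variable c ℓ c₁ ℓ₁ c₂ ℓ₂ r : Level

IsFiniteGroup : Group c ℓ → Set (c ⊔ ℓ)
IsFiniteGroup G = ∃ λ n → Inverse (Group.setoid G) (≡.setoid (Fin n))

Nontrivial : Group c ℓ → Set (c ⊔ ℓ)
Nontrivial G = ∃ λ x → ¬ (x ≈ ε)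
  where open Group G

pow : (G : Group c ℓ) → Group.Carrier G → ℕ → Group.Carrier G
pow G x zero    = Group.ε G
pow G x (suc n) = Group._∙_ G x (pow G x n)

record Graph c ℓ r : Set (Level.suc (c ⊔ ℓ ⊔ r)) where
  field
    vertices : Setoid c ℓ
    adj      : Rel (Setoid.Carrier vertices) r

PowerGraph : Group c ℓ → Graph c ℓ ℓ
PowerGraph G = record
  { vertices = Group.setoid G
  ; adj = λ a b → ¬ (a ≈ b) ×
            ((∃ λ m → pow G a (suc m) ≈ b) ⊎ (∃ λ n → pow G b (suc n) ≈ a))
  }
  where open Group G

_⊗_ : Group c₁ ℓ₁ → Group c₂ ℓ₂ → Group (c₁ ⊔ c₂) (ℓ₁ ⊔ ℓ₂)
G₁ ⊗ G₂ = DP.group G₁ G₂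

_□_ : ∀ {r₁ r₂} → Graph c₁ ℓ₁ r₁ → Graph c₂ ℓ₂ r₂ →
      Graph (c₁ ⊔ c₂) (ℓ₁ ⊔ ℓ₂) (ℓ₁ ⊔ ℓ₂ ⊔ r₁ ⊔ r₂)
Γ₁ □ Γ₂ = record
  { vertices = ×-setoid (Graph.vertices Γ₁) (Graph.vertices Γ₂)
  ; adj = λ { (g₁ , g₂) (h₁ , h₂) →
        (Setoid._≈_ (Graph.vertices Γ₁) g₁ h₁ × Graph.adj Γ₂ g₂ h₂)
      ⊎ (Graph.adj Γ₁ g₁ h₁ × Setoid._≈_ (Graph.vertices Γ₂) g₂ h₂) }
  }

_≅_ : ∀ {c₁ ℓ₁ r₁ c₂ ℓ₂ r₂} → Graph c₁ ℓ₁ r₁ → Graph c₂ ℓ₂ r₂ →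
      Set (c₁ ⊔ ℓ₁ ⊔ r₁ ⊔ c₂ ⊔ ℓ₂ ⊔ r₂)
Γ₁ ≅ Γ₂ = Σ (Inverse (Graph.vertices Γ₁) (Graph.vertices Γ₂)) λ f →
  ∀ a b → Graph.adj Γ₁ a b ⇔ Graph.adj Γ₂ (Inverse.to f a) (Inverse.to f b)

-- In a finite group every element x has a positive power equal to the identity,
-- so the identity is adjacent to every other vertex of the power graph. In a
-- cartesian product of graphs adjacent vertices share a coordinate, so when both
-- factors have two vertices, no vertex (a, b) is adjacent to any (a', b') with
-- a' ≠ a and b' ≠ b. An isomorphism would send the identity of G₁ × G₂ to such
-- an (a, b) and still have to make it adjacent to the preimage of (a', b').
module Submission where

open import Defs
open import Level using (Level; _⊔_)
open import Relation.Nullary using (¬_)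
open import Algebra.Bundles using (Group)

open import Data.Nat using (zero; suc; _+_; _*_; _∸_; _<_)
open import Data.Nat.Properties using (n<1+n; +-suc; m+[n∸m]≡n; *-comm)
open import Data.Fin using (toℕ)
open import Data.Fin.Properties using (pigeonhole)
open import Data.Product using (∃; _,_; proj₁; proj₂)
open import Data.Sum using (_⊎_; inj₁; inj₂; [_,_]; [_,_]′)
open import Function using (_∘_)
open import Function.Bundles using (Inverse; Injection; Equivalence)
open import Function.Properties.Inverse using (Inverse⇒Injection)
open import Relation.Binary.Bundles using (Setoid)
import Relation.Binary.PropositionalEquality as ≡
open import Algebra.Properties.Group using (∙-cancelˡ)

IsTorsion : ∀ {c ℓ} → Group c ℓ → Set (c ⊔ ℓ)
IsTorsion G = ∀ x → ∃ λ m → pow G x (suc m) ≈ ε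
  where open Group G

module _ {c ℓ} (G : Group c ℓ) where
  open Group G
  open import Relation.Binary.Reasoning.Setoid setoid

  pow-+ : ∀ x m n → pow G x (m + n) ≈ pow G x m ∙ pow G x n
  pow-+ x zero    n = sym (identityˡ _)
  pow-+ x (suc m) n = trans (∙-congˡ (pow-+ x m n)) (sym (assoc _ _ _))

  pow-*-≈ε : ∀ x n k → pow G x n ≈ ε → pow G x (k * n) ≈ ε
  pow-*-≈ε x n zero    xⁿ≈ε = refl
  pow-*-≈ε x n (suc k) xⁿ≈ε = begin
    pow G x (n + k * n)          ≈⟨ pow-+ x n (k * n) ⟩
    pow G x n ∙ pow G x (k * n)  ≈⟨ ∙-cong xⁿ≈ε (pow-*-≈ε x n k xⁿ≈ε) ⟩
    ε ∙ ε                        ≈⟨ identityˡ ε ⟩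
    ε                            ∎

  pow-≈-pow⇒pow-∸-≈ε : ∀ x {i j} → i < j → pow G x i ≈ pow G x j →
                       pow G x (suc (j ∸ suc i)) ≈ ε
  pow-≈-pow⇒pow-∸-≈ε x {i} {j} i<j xⁱ≈xʲ = ∙-cancelˡ G _ _ _ (begin
    pow G x i ∙ pow G x (suc d)  ≈⟨ pow-+ x i (suc d) ⟨
    pow G x (i + suc d)          ≡⟨ ≡.cong (pow G x) (≡.trans (+-suc i d) (m+[n∸m]≡n i<j)) ⟩
    pow G x j                    ≈⟨ xⁱ≈xʲ ⟨
    pow G x i                    ≈⟨ identityʳ _ ⟨
    pow G x i ∙ ε                ∎)
    where d = j ∸ suc i

  -- Pigeonhole on the n + 1 powers x⁰, …, xⁿ in a group of order n.
  finite⇒torsion : IsFiniteGroup G → IsTorsion G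
  finite⇒torsion (n , G↔Fin) x
    with i , j , i<j , xⁱ≡xʲ ← pigeonhole (n<1+n n) (Inverse.to G↔Fin ∘ pow G x ∘ toℕ)
    = toℕ j ∸ suc (toℕ i) , pow-≈-pow⇒pow-∸-≈ε x i<j (Injection.injective (Inverse⇒Injection G↔Fin) xⁱ≡xʲ)

  nontrivial⇒¬¬≉ : Nontrivial G → ∀ a → ¬ ¬ ∃ λ a' → ¬ a' ≈ a
  nontrivial⇒¬¬≉ (x , x≉ε) a none =
    none (ε , λ ε≈a → none (x , λ x≈a → x≉ε (trans x≈a (sym ε≈a))))

module _ {c₁ ℓ₁ c₂ ℓ₂} (G₁ : Group c₁ ℓ₁) (G₂ : Group c₂ ℓ₂) where
  private
    module G₁ = Group G₁
    module G₂ = Group G₂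
    module P  = Group (G₁ ⊗ G₂)

  pow-⊗ : ∀ x y k → pow (G₁ ⊗ G₂) (x , y) k P.≈ (pow G₁ x k , pow G₂ y k)
  pow-⊗ x y zero    = G₁.refl , G₂.refl
  pow-⊗ x y (suc k) = G₁.∙-congˡ (proj₁ (pow-⊗ x y k)) , G₂.∙-congˡ (proj₂ (pow-⊗ x y k))

  -- The exponent (m₁ + 1)(m₂ + 1) kills both coordinates.
  torsion-⊗ : IsTorsion G₁ → IsTorsion G₂ → IsTorsion (G₁ ⊗ G₂)
  torsion-⊗ tor₁ tor₂ (x , y)
    with m₁ , xᵐ¹≈ε ← tor₁ x | m₂ , yᵐ²≈ε ← tor₂ y
    = m₁ + m₂ * suc m₁ , P.trans (pow-⊗ x y (suc m₂ * suc m₁))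
                  ( pow-*-≈ε G₁ x (suc m₁) (suc m₂) xᵐ¹≈ε
                  , G₂.trans (G₂.reflexive (≡.cong (pow G₂ y) (*-comm (suc m₂) (suc m₁))))
                             (pow-*-≈ε G₂ y (suc m₂) (suc m₁) yᵐ²≈ε))

Dominating : ∀ {c ℓ r} (Γ : Graph c ℓ r) → Setoid.Carrier (Graph.vertices Γ) → Set (c ⊔ ℓ ⊔ r)
Dominating Γ v = ∀ w → ¬ v ≈ w → Graph.adj Γ v w
  where open Setoid (Graph.vertices Γ)

torsion⇒ε-dominating : ∀ {c ℓ} (G : Group c ℓ) → IsTorsion G → Dominating (PowerGraph G) (Group.ε G)
torsion⇒ε-dominating G tor u ε≉u = ε≉u , inj₂ (tor u)

≅-dominating : ∀ {c₁ ℓ₁ r₁ c₂ ℓ₂ r₂} (Γ₁ : Graph c₁ ℓ₁ r₁) (Γ₂ : Graph c₂ ℓ₂ r₂)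
               ((f , _) : Γ₁ ≅ Γ₂) {v : Setoid.Carrier (Graph.vertices Γ₁)} → Dominating Γ₁ v →
               ∀ u → ¬ Setoid._≈_ (Graph.vertices Γ₂) (Inverse.to f v) (Inverse.to f u) →
               Graph.adj Γ₂ (Inverse.to f v) (Inverse.to f u)
≅-dominating _ _ (f , f-adj) {v} v-dom u fv≉fu =
  Equivalence.to (f-adj v u) (v-dom u (fv≉fu ∘ Inverse.to-cong f))

□-adj⇒shares-coordinate : ∀ {c₁ ℓ₁ r₁ c₂ ℓ₂ r₂} (Γ₁ : Graph c₁ ℓ₁ r₁) (Γ₂ : Graph c₂ ℓ₂ r₂)
                          {a a' b b'} → Graph.adj (Γ₁ □ Γ₂) (a , b) (a' , b') →
                          Setoid._≈_ (Graph.vertices Γ₁) a a' ⊎ Setoid._≈_ (Graph.vertices Γ₂) b b'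
□-adj⇒shares-coordinate _ _ = [ inj₁ ∘ proj₁ , inj₂ ∘ proj₂ ]

mainTheorem1 : ∀ {c₁ ℓ₁ c₂ ℓ₂ : Level} (G₁ : Group c₁ ℓ₁) (G₂ : Group c₂ ℓ₂) →
    IsFiniteGroup G₁ → IsFiniteGroup G₂ → Nontrivial G₁ → Nontrivial G₂ →
    ¬ (PowerGraph (G₁ ⊗ G₂) ≅ (PowerGraph G₁ □ PowerGraph G₂))
mainTheorem1 G₁ G₂ fin₁ fin₂ nt₁ nt₂ iso@(f , _) =
  nontrivial⇒¬¬≉ G₁ nt₁ a λ (a' , a'≉a) →
  nontrivial⇒¬¬≉ G₂ nt₂ b λ (b' , b'≉b) →
  let u = from (a' , b')
      (u₁≈a' , u₂≈b') = strictlyInverseˡ (a' , b')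
      a≉u₁ a≈u₁ = a'≉a (G₁.sym (G₁.trans a≈u₁ u₁≈a'))
      b≉u₂ b≈u₂ = b'≉b (G₂.sym (G₂.trans b≈u₂ u₂≈b'))
      ε⊗-dominating = torsion⇒ε-dominating (G₁ ⊗ G₂)
                        (torsion-⊗ G₁ G₂ (finite⇒torsion G₁ fin₁) (finite⇒torsion G₂ fin₂))
      fε-adj-fu = ≅-dominating (PowerGraph (G₁ ⊗ G₂)) (PowerGraph G₁ □ PowerGraph G₂)
                    iso ε⊗-dominating u (a≉u₁ ∘ proj₁)
  in [ a≉u₁ , b≉u₂ ]′ (□-adj⇒shares-coordinate (PowerGraph G₁) (PowerGraph G₂) fε-adj-fu)
  where
  module G₁ = Group G₁
  module G₂ = Group G₂
  open Inverse f
  a = proj₁ (to (Group.ε (G₁ ⊗ G₂)))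
  b = proj₂ (to (Group.ε (G₁ ⊗ G₂)))
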